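{- Let $k,n$ be positive integers with $2k<n$ and $n>4$. For a permutation $\sigma\in S_n$, let $F_\sigma$ be the set of $k$-element subsets $v\subseteq[n]$ with $\sigma(v)=v$. Then for every non-identity $\sigma\in S_n$, $$|F_\sigma|\le \binom{n-2}{k-2}+\binom{n-2}{k},$$ and equality holds if and only if $\sigma$ is a transposition $(i\,j)$ with $i\neq j$.
   Context: $[n]=\{1,\dots,n\}$; $S_n$ acts on subsets of $[n]$ elementwise. Binomial coefficients $\binom{m}{j}$ with $j<0$ are $0$. -}

module Defs where

open import Data.Nat using (ℕ; zero; suc)
open import Data.Bool using (Bool; true; false)
import Data.Bool.Properties as BoolP
open import Data.Fin using (Fin)
open import Data.Fin.Subset using (Subset; ∣_∣)
open import Data.Fin.Permutation using (Permutation′; _⟨$⟩ʳ_; _⟨$⟩ˡ_; transpose)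
open import Data.Vec using (Vec; []; _∷_; lookup; tabulate)
import Data.Vec.Properties as VecP
open import Data.List using (List; []; _∷_; map; _++_; filter; length)
open import Data.Product using (Σ; _×_; _,_)
open import Relation.Nullary using (¬_; Dec)
open import Relation.Nullary.Decidable using (_×-dec_)
open import Relation.Binary.PropositionalEquality using (_≡_; _≢_)
open import Data.Nat.Combinatorics using (_C_)
import Data.Nat.Properties as NatP

allSubsets : (n : ℕ) → List (Subset n)
allSubsets zero = [] ∷ []
allSubsets (suc n) = map (true ∷_) (allSubsets n) ++ map (false ∷_) (allSubsets n)

-- the image σ(v) = { σ x | x ∈ v }:  j ∈ σ(v)  iff  σ⁻¹ j ∈ v
image : {n : ℕ} → Permutation′ n → Subset n → Subset n
image σ v = tabulate (λ j → lookup v (σ ⟨$⟩ˡ j))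

isFixedKSubset : {n : ℕ} (k : ℕ) (σ : Permutation′ n) (v : Subset n) →
                 Dec ((∣ v ∣ ≡ k) × (image σ v ≡ v))
isFixedKSubset k σ v = (∣ v ∣ NatP.≟ k) ×-dec VecP.≡-dec BoolP._≟_ (image σ v) v

-- F_σ as a list (without repetition) of the fixed k-subsets
F : {n : ℕ} (k : ℕ) (σ : Permutation′ n) → List (Subset n)
F k σ = filter (isFixedKSubset k σ) (allSubsets _)

numF : {n : ℕ} (k : ℕ) (σ : Permutation′ n) → ℕ
numF k σ = length (F k σ)

IsIdentity : {n : ℕ} → Permutation′ n → Set
IsIdentity σ = ∀ x → σ ⟨$⟩ʳ x ≡ x

IsTransposition : {n : ℕ} → Permutation′ n → Set
IsTransposition {n} σ =
  Σ (Fin n) λ i → Σ (Fin n) λ j → (i ≢ j) × (∀ x → σ ⟨$⟩ʳ x ≡ transpose i j ⟨$⟩ʳ x)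

-- binom m (k - 2) with the convention binom m j = 0 for j < 0
binomKm2 : ℕ → ℕ → ℕ
binomKm2 m zero = 0
binomKm2 m (suc zero) = 0
binomKm2 m (suc (suc j)) = m C j

module Submission where

-- If σ moves a to b ≠ a, every σ-invariant k-set contains both or neither of a and b, and
-- by Pascal's rule there are exactly C(n-2,k-2) + C(n-2,k) such k-sets; they are precisely
-- the invariant k-sets of the transposition (a b). Conversely, equality makes all of them
-- σ-invariant. Since k + 3 ≤ n, if σ b ≠ a (take y = b) or σ y ≠ y for some y ∉ {a, b},
-- one of them contains exactly one of y and σ y and so is not invariant; hence σ = (a b).

open import Defs
open import Data.Bool.Base using (Bool)
open import Data.Bool.Properties using () renaming (_≟_ to _≟ᵇ_)
open import Data.Empty using (⊥-elim)
open import Data.Fin.Base using (Fin; zero; suc)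
open import Data.Fin.Permutation
  using (Permutation′; _⟨$⟩ʳ_; _⟨$⟩ˡ_; transpose; inverseˡ; inverseʳ)
open import Data.Fin.Properties using (¬∀⟶∃¬) renaming (_≟_ to _≟ᶠ_)
open import Data.Fin.Subset using (Subset; ∣_∣; inside; outside; _⊆_; _∈_; _∉_; _∪_; ⁅_⁆; ∁)
open import Data.Fin.Subset.Properties
  using ( ∣p∣≤∣x∷p∣; out⊆; in⊆in; s⊆s; drop-∷-⊆; p⊆q⇒∣p∣≤∣q∣; ∣⁅x⁆∣≡1; ∣∁p∣≡n∸∣p∣
        ; x∈⁅x⁆; x∈⁅y⁆⇒x≡y; x∈p∪q⁻; x∈p∪q⁺; x∉p⇒x∈∁p; x∈p⇒x∉∁p)
open import Data.List.Base using ([]; _∷_; _++_; length; filter; map)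
open import Data.List.Membership.Propositional using () renaming (_∈_ to _∈ˡ_)
open import Data.List.Membership.Propositional.Properties
  using (∈-++⁺ˡ; ∈-++⁺ʳ; ∈-map⁺; ∈-filter⁺; ∈-filter⁻)
open import Data.List.Properties using (length-++; length-map; filter-++; filter-≐; filter-none)
open import Data.List.Relation.Binary.Equality.Propositional using (≋⇒≡)
open import Data.List.Relation.Binary.Sublist.Propositional using (⊆-refl) renaming (_⊆_ to Sublist)
open import Data.List.Relation.Binary.Sublist.Propositional.Properties
  using (filter⁺; length-mono-≤; to-≋)
import Data.List.Relation.Unary.All as All
open import Data.List.Relation.Unary.Any using (here)
open import Data.Nat.Base using (ℕ; zero; suc; _+_; _*_; _∸_; _≤_; _<_; z≤n; s≤s)
open import Data.Nat.Combinatorics using (_C_; nCk+nC[k+1]≡[n+1]C[k+1])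
open import Data.Nat.Properties
  using ( _≟_; _≤?_; suc-injective; +-identityʳ; +-commutativeSemigroup; ≤-trans; ≤-pred
        ; ≤-reflexive; ≰⇒>; +-suc; +-monoˡ-≤; +-monoʳ-≤; m+n≤o⇒m≤o∸n; module ≤-Reasoning)
open import Algebra.Properties.CommutativeSemigroup +-commutativeSemigroup using (interchange)
open import Data.Product using (∃-syntax; _×_; _,_; proj₁; proj₂; map₁; map₂)
open import Data.Sum using (inj₁; inj₂; [_,_]′)
open import Data.Vec.Base using ([]; _∷_; here; lookup)
open import Data.Vec.Properties
  using ([]=⇒lookup; lookup⇒[]=; lookup∘tabulate; tabulate∘lookup; tabulate-cong; ≡-dec)
open import Function.Base using (_∘_)
open import Function.Bundles using (_⇔_; mk⇔; Injection)
open import Function.Properties.Inverse using (↔⇒↣)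
open import Relation.Nullary using (¬_; yes; no; contradiction)
open import Relation.Nullary.Decidable using (_×-dec_; decidable-stable)
open import Relation.Unary using (Decidable; Universal; Empty) renaming (_⊆_ to _⊆′_; _≐_ to _≐′_)
open import Relation.Binary.PropositionalEquality

module _ {A B : Set} {P : B → Set} (P? : Decidable P) (f : A → B) where

  filter-map : ∀ xs → filter P? (map f xs) ≡ map f (filter (P? ∘ f) xs)
  filter-map []       = refl
  filter-map (x ∷ xs) with P? (f x)
  ... | yes _ = cong (f x ∷_) (filter-map xs)
  ... | no  _ = filter-map xs

count : ∀ n {P : Subset n → Set} → Decidable P → ℕ
count n P? = length (filter P? (allSubsets n))

allSubsets-complete : ∀ n (v : Subset n) → v ∈ˡ allSubsets n
allSubsets-complete zero    []            = here refl
allSubsets-complete (suc n) (inside ∷ v)  = ∈-++⁺ˡ (∈-map⁺ (inside ∷_) (allSubsets-complete n v))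
allSubsets-complete (suc n) (outside ∷ v) = ∈-++⁺ʳ _ (∈-map⁺ (outside ∷_) (allSubsets-complete n v))

module _ {n : ℕ} {P Q : Subset n → Set} (P? : Decidable P) (Q? : Decidable Q) where

  private
    filter-sublist : P ⊆′ Q → Sublist (filter P? (allSubsets n)) (filter Q? (allSubsets n))
    filter-sublist P⊆Q = filter⁺ P? Q? (λ { refl → P⊆Q }) (⊆-refl {x = allSubsets n})

  count-cong : P ≐′ Q → count n P? ≡ count n Q?
  count-cong P≐Q = cong length (filter-≐ P? Q? P≐Q (allSubsets n))

  count-mono : P ⊆′ Q → count n P? ≤ count n Q?
  count-mono P⊆Q = length-mono-≤ (filter-sublist P⊆Q)

  count-mono-≡⇒⊇ : P ⊆′ Q → count n P? ≡ count n Q? → Q ⊆′ P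
  count-mono-≡⇒⊇ P⊆Q eq {v} Qv =
    proj₂ (∈-filter⁻ P? {xs = allSubsets n} (subst (v ∈ˡ_) filterP≡filterQ v∈filterQ))
    where
    v∈filterQ : v ∈ˡ filter Q? (allSubsets n)
    v∈filterQ = ∈-filter⁺ Q? (allSubsets-complete n v) Qv
    filterP≡filterQ : filter Q? (allSubsets n) ≡ filter P? (allSubsets n)
    filterP≡filterQ = sym (≋⇒≡ (to-≋ eq (filter-sublist P⊆Q)))

count-∅ : ∀ n {P : Subset n → Set} (P? : Decidable P) → Empty P → count n P? ≡ 0
count-∅ n P? ∅ = cong length (filter-none P? {xs = allSubsets n} (All.universal ∅ (allSubsets n)))

count-cons : ∀ n {P : Subset (suc n) → Set} (P? : Decidable P) →
  count (suc n) P? ≡ count n (P? ∘ (inside ∷_)) + count n (P? ∘ (outside ∷_))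
count-cons n P? = begin
  length (filter P? (map (inside ∷_) vs ++ map (outside ∷_) vs))
    ≡⟨ cong length (filter-++ P? (map (inside ∷_) vs) (map (outside ∷_) vs)) ⟩
  length (filter P? (map (inside ∷_) vs) ++ filter P? (map (outside ∷_) vs))
    ≡⟨ length-++ (filter P? (map (inside ∷_) vs)) ⟩
  length (filter P? (map (inside ∷_) vs)) + length (filter P? (map (outside ∷_) vs))
    ≡⟨ cong₂ _+_ (filter-map-length (inside ∷_)) (filter-map-length (outside ∷_)) ⟩
  count n (P? ∘ (inside ∷_)) + count n (P? ∘ (outside ∷_)) ∎
  where
  open ≡-Reasoning
  vs = allSubsets n
  filter-map-length : ∀ f → length (filter P? (map f vs)) ≡ length (filter (P? ∘ f) vs)
  filter-map-length f = trans (cong length (filter-map P? f vs)) (length-map f (filter (P? ∘ f) vs))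

sized? : ∀ {n} k {P : Subset n → Set} → Decidable P → Decidable (λ v → ∣ v ∣ ≡ k × P v)
sized? k P? v = (∣ v ∣ ≟ k) ×-dec P? v

module _ (n : ℕ) {P : Subset (suc n) → Set} (P? : Decidable P) where

  count-sized-zero-cons : count (suc n) (sized? 0 P?) ≡ count n (sized? 0 (P? ∘ (outside ∷_)))
  count-sized-zero-cons = trans (count-cons n (sized? 0 P?))
    (cong (_+ count n (sized? 0 (P? ∘ (outside ∷_)))) (count-∅ n _ (λ v ())))

  count-sized-suc-cons : ∀ k → count (suc n) (sized? (suc k) P?) ≡
    count n (sized? k (P? ∘ (inside ∷_))) + count n (sized? (suc k) (P? ∘ (outside ∷_)))
  count-sized-suc-cons k = trans (count-cons n (sized? (suc k) P?))
    (cong (_+ count n (sized? (suc k) (P? ∘ (outside ∷_))))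
      (count-cong _ (sized? k (P? ∘ (inside ∷_))) (map₁ suc-injective , map₁ (cong suc))))

count-sized-cong : ∀ n k {P Q : Subset n → Set} (P? : Decidable P) (Q? : Decidable Q) →
  P ≐′ Q → count n (sized? k P?) ≡ count n (sized? k Q?)
count-sized-cong n k P? Q? (P⊆Q , Q⊆P) =
  count-cong (sized? k P?) (sized? k Q?) (map₂ P⊆Q , map₂ Q⊆P)

count-sized-∅ : ∀ n k {P : Subset n → Set} (P? : Decidable P) → Empty P → count n (sized? k P?) ≡ 0
count-sized-∅ n k P? ∅ = count-∅ n (sized? k P?) (λ v → ∅ v ∘ proj₂)

count-sized-universal : ∀ n k {P : Subset n → Set} (P? : Decidable P) → Universal P →
                        count n (sized? k P?) ≡ n C k
count-sized-universal zero zero P? all with P? []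
... | yes _  = refl
... | no ¬P = ⊥-elim (¬P (all []))
count-sized-universal zero (suc k) P? all = refl
count-sized-universal (suc n) zero P? all =
  trans (count-sized-zero-cons n P?) (count-sized-universal n zero _ (all ∘ (outside ∷_)))
count-sized-universal (suc n) (suc k) P? all = begin
  count (suc n) (sized? (suc k) P?)
    ≡⟨ count-sized-suc-cons n P? k ⟩
  count n (sized? k (P? ∘ (inside ∷_))) + count n (sized? (suc k) (P? ∘ (outside ∷_)))
    ≡⟨ cong₂ _+_ (count-sized-universal n k _ (all ∘ (inside ∷_)))
                 (count-sized-universal n (suc k) _ (all ∘ (outside ∷_))) ⟩
  n C k + n C suc k
    ≡⟨ nCk+nC[k+1]≡[n+1]C[k+1] n k ⟩
  suc n C suc k ∎
  where open ≡-Reasoning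

binomKm2-pascal : ∀ m k → binomKm2 m k + binomKm2 m (suc k) ≡ binomKm2 (suc m) (suc k)
binomKm2-pascal m zero          = refl
binomKm2-pascal m (suc zero)    = refl
binomKm2-pascal m (suc (suc k)) = nCk+nC[k+1]≡[n+1]C[k+1] m k

entryCount : Bool → ℕ → ℕ → ℕ
entryCount inside  m k = binomKm2 m (suc k)
entryCount outside m k = m C k

entryCount-zero : ∀ β m → entryCount β (suc m) 0 ≡ entryCount β m 0
entryCount-zero inside  m = refl
entryCount-zero outside m = refl

entryCount-pascal : ∀ β m k →
  entryCount β m k + entryCount β m (suc k) ≡ entryCount β (suc m) (suc k)
entryCount-pascal inside  m k = binomKm2-pascal m (suc k)
entryCount-pascal outside m k = nCk+nC[k+1]≡[n+1]C[k+1] m k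

pairCount : ℕ → ℕ → ℕ
pairCount m k = binomKm2 m k + m C k

pairCount-pascal : ∀ m k → pairCount m k + pairCount m (suc k) ≡ pairCount (suc m) (suc k)
pairCount-pascal m k = trans (interchange (binomKm2 m k) (m C k) (binomKm2 m (suc k)) (m C suc k))
  (cong₂ _+_ (binomKm2-pascal m k) (nCk+nC[k+1]≡[n+1]C[k+1] m k))

entry? : ∀ {n} (b : Fin n) (β : Bool) → Decidable (λ (v : Subset n) → lookup v b ≡ β)
entry? b β v = lookup v b ≟ᵇ β

count-sized-entry : ∀ m k (b : Fin (suc m)) β →
  count (suc m) (sized? k (entry? b β)) ≡ entryCount β m k
count-sized-entry m zero zero inside =
  trans (count-sized-zero-cons m (entry? zero inside))
        (count-sized-∅ m 0 (entry? zero inside ∘ (outside ∷_)) (λ v ()))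
count-sized-entry m zero zero outside =
  trans (count-sized-zero-cons m (entry? zero outside))
        (count-sized-universal m 0 (entry? zero outside ∘ (outside ∷_)) (λ v → refl))
count-sized-entry m (suc k) zero inside =
  trans (count-sized-suc-cons m (entry? zero inside) k)
        (trans (cong₂ _+_
                 (count-sized-universal m k (entry? zero inside ∘ (inside ∷_)) (λ v → refl))
                 (count-sized-∅ m (suc k) (entry? zero inside ∘ (outside ∷_)) (λ v ())))
               (+-identityʳ (m C k)))
count-sized-entry m (suc k) zero outside =
  trans (count-sized-suc-cons m (entry? zero outside) k)
        (cong₂ _+_
          (count-sized-∅ m k (entry? zero outside ∘ (inside ∷_)) (λ v ()))
          (count-sized-universal m (suc k) (entry? zero outside ∘ (outside ∷_)) (λ v → refl)))
count-sized-entry (suc m) zero (suc b) β =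
  trans (count-sized-zero-cons (suc m) (entry? (suc b) β))
        (trans (count-sized-entry m zero b β) (sym (entryCount-zero β m)))
count-sized-entry (suc m) (suc k) (suc b) β = begin
  count (suc (suc m)) (sized? (suc k) (entry? (suc b) β))
    ≡⟨ count-sized-suc-cons (suc m) (entry? (suc b) β) k ⟩
  count (suc m) (sized? k (entry? b β)) + count (suc m) (sized? (suc k) (entry? b β))
    ≡⟨ cong₂ _+_ (count-sized-entry m k b β) (count-sized-entry m (suc k) b β) ⟩
  entryCount β m k + entryCount β m (suc k)
    ≡⟨ entryCount-pascal β m k ⟩
  entryCount β (suc m) (suc k) ∎
  where open ≡-Reasoning

agree? : ∀ {n} (a b : Fin n) → Decidable (λ (v : Subset n) → lookup v a ≡ lookup v b)
agree? a b v = lookup v a ≟ᵇ lookup v b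

count-sized-entry-sym : ∀ m k (b : Fin (suc m)) β →
  count (suc m) (sized? k (λ v → β ≟ᵇ lookup v b)) ≡ entryCount β m k
count-sized-entry-sym m k b β =
  trans (count-sized-cong (suc m) k _ (entry? b β) (sym , sym)) (count-sized-entry m k b β)

count-sized-agree-zero : ∀ m k (b : Fin (suc m)) →
  count (suc (suc m)) (sized? k (agree? zero (suc b))) ≡ pairCount m k
count-sized-agree-zero m zero b =
  trans (count-sized-zero-cons (suc m) (agree? zero (suc b))) (count-sized-entry-sym m 0 b outside)
count-sized-agree-zero m (suc k) b =
  trans (count-sized-suc-cons (suc m) (agree? zero (suc b)) k)
        (cong₂ _+_ (count-sized-entry-sym m k b inside) (count-sized-entry-sym m (suc k) b outside))

count-sized-agree : ∀ m k (a b : Fin (suc (suc m))) → a ≢ b →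
  count (suc (suc m)) (sized? k (agree? a b)) ≡ pairCount m k
count-sized-agree m k zero zero a≢b = ⊥-elim (a≢b refl)
count-sized-agree m k zero (suc b) _ = count-sized-agree-zero m k b
count-sized-agree m k (suc a) zero _ =
  trans (count-sized-cong (suc (suc m)) k (agree? (suc a) zero) (agree? zero (suc a)) (sym , sym))
        (count-sized-agree-zero m k a)
count-sized-agree zero k (suc zero) (suc zero) a≢b = ⊥-elim (a≢b refl)
count-sized-agree (suc m) zero (suc a) (suc b) a≢b =
  trans (count-sized-zero-cons (suc (suc m)) (agree? (suc a) (suc b)))
        (count-sized-agree m zero a b (a≢b ∘ cong suc))
count-sized-agree (suc m) (suc k) (suc a) (suc b) a≢b = begin
  count (suc (suc (suc m))) (sized? (suc k) (agree? (suc a) (suc b)))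
    ≡⟨ count-sized-suc-cons (suc (suc m)) (agree? (suc a) (suc b)) k ⟩
  count (suc (suc m)) (sized? k (agree? a b)) + count (suc (suc m)) (sized? (suc k) (agree? a b))
    ≡⟨ cong₂ _+_ (count-sized-agree m k a b a≢b′) (count-sized-agree m (suc k) a b a≢b′) ⟩
  pairCount m k + pairCount m (suc k)
    ≡⟨ pairCount-pascal m k ⟩
  pairCount (suc m) (suc k) ∎
  where
  open ≡-Reasoning
  a≢b′ = a≢b ∘ cong suc

∣p∪q∣≤∣p∣+∣q∣ : ∀ {n} (p q : Subset n) → ∣ p ∪ q ∣ ≤ ∣ p ∣ + ∣ q ∣
∣p∪q∣≤∣p∣+∣q∣ []            []            = z≤n
∣p∪q∣≤∣p∣+∣q∣ (inside  ∷ p) (x       ∷ q) =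
  s≤s (≤-trans (∣p∪q∣≤∣p∣+∣q∣ p q) (+-monoʳ-≤ ∣ p ∣ (∣p∣≤∣x∷p∣ x q)))
∣p∪q∣≤∣p∣+∣q∣ (outside ∷ p) (inside  ∷ q) =
  ≤-trans (s≤s (∣p∪q∣≤∣p∣+∣q∣ p q)) (≤-reflexive (sym (+-suc ∣ p ∣ ∣ q ∣)))
∣p∪q∣≤∣p∣+∣q∣ (outside ∷ p) (outside ∷ q) = ∣p∪q∣≤∣p∣+∣q∣ p q

∃-sized-between : ∀ {n} {u w : Subset n} k → u ⊆ w → ∣ u ∣ ≤ k → k ≤ ∣ w ∣ →
                  ∃[ v ] u ⊆ v × v ⊆ w × ∣ v ∣ ≡ k
∃-sized-between {u = []} {[]} zero u⊆w _ _ = [] , u⊆w , u⊆w , refl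
∃-sized-between {u = inside ∷ u} {outside ∷ w} k u⊆w _ _ with u⊆w here
... | ()
∃-sized-between {u = inside ∷ u} {inside ∷ w} (suc k) u⊆w (s≤s u≤k) (s≤s k≤w)
  with ∃-sized-between k (drop-∷-⊆ u⊆w) u≤k k≤w
... | v , u⊆v , v⊆w , ∣v∣≡k = inside ∷ v , in⊆in u⊆v , in⊆in v⊆w , cong suc ∣v∣≡k
∃-sized-between {u = outside ∷ u} {outside ∷ w} k u⊆w u≤k k≤w
  with ∃-sized-between k (drop-∷-⊆ u⊆w) u≤k k≤w
... | v , u⊆v , v⊆w , ∣v∣≡k = outside ∷ v , s⊆s u⊆v , s⊆s v⊆w , ∣v∣≡k
∃-sized-between {u = outside ∷ u} {inside ∷ w} k u⊆w u≤k _ with k ≤? ∣ w ∣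
... | yes k≤w with ∃-sized-between k (drop-∷-⊆ u⊆w) u≤k k≤w
...   | v , u⊆v , v⊆w , ∣v∣≡k = outside ∷ v , s⊆s u⊆v , out⊆ v⊆w , ∣v∣≡k
∃-sized-between {u = outside ∷ u} {inside ∷ w} (suc k) u⊆w _ (s≤s k≤w) | no k≰w
  with ∃-sized-between k (drop-∷-⊆ u⊆w)
         (≤-trans (p⊆q⇒∣p∣≤∣q∣ (drop-∷-⊆ u⊆w)) (≤-pred (≰⇒> k≰w))) k≤w
... | v , u⊆v , v⊆w , ∣v∣≡k = inside ∷ v , out⊆ u⊆v , in⊆in v⊆w , cong suc ∣v∣≡k
∃-sized-between {u = outside ∷ u} {inside ∷ w} zero _ _ _ | no k≰w = ⊥-elim (k≰w z≤n)

∉⇒lookup≡outside : ∀ {n} {x : Fin n} {v : Subset n} → x ∉ v → lookup v x ≡ outside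
∉⇒lookup≡outside {x = x} {v} x∉v with lookup v x in eq
... | inside  = ⊥-elim (x∉v (lookup⇒[]= x v eq))
... | outside = refl

∃-sized-∋-avoiding : ∀ {n} k (z : Fin n) (F : Subset n) → z ∉ F → 1 ≤ k → k + ∣ F ∣ ≤ n →
  ∃[ v ] ∣ v ∣ ≡ k × lookup v z ≡ inside × (∀ {x} → x ∈ F → lookup v x ≡ outside)
∃-sized-∋-avoiding k z F z∉F 1≤k k+∣F∣≤n
  with ∃-sized-between k ⁅z⁆⊆∁F (≤-trans (≤-reflexive (∣⁅x⁆∣≡1 z)) 1≤k) k≤∣∁F∣
  where
  ⁅z⁆⊆∁F : ⁅ z ⁆ ⊆ ∁ F
  ⁅z⁆⊆∁F x∈⁅z⁆ rewrite x∈⁅y⁆⇒x≡y z x∈⁅z⁆ = x∉p⇒x∈∁p z∉F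
  k≤∣∁F∣ : k ≤ ∣ ∁ F ∣
  k≤∣∁F∣ = ≤-trans (m+n≤o⇒m≤o∸n k k+∣F∣≤n) (≤-reflexive (sym (∣∁p∣≡n∸∣p∣ F)))
... | v , ⁅z⁆⊆v , v⊆∁F , ∣v∣≡k =
  v , ∣v∣≡k , []=⇒lookup (⁅z⁆⊆v (x∈⁅x⁆ z)) , λ x∈F → ∉⇒lookup≡outside (x∈p⇒x∉∁p x∈F ∘ v⊆∁F)

∣⁅x⁆∪⁅y⁆∪⁅z⁆∣≤3 : ∀ {n} (x y z : Fin n) → ∣ ⁅ x ⁆ ∪ ⁅ y ⁆ ∪ ⁅ z ⁆ ∣ ≤ 3
∣⁅x⁆∪⁅y⁆∪⁅z⁆∣≤3 x y z = begin
  ∣ ⁅ x ⁆ ∪ ⁅ y ⁆ ∪ ⁅ z ⁆ ∣           ≤⟨ ∣p∪q∣≤∣p∣+∣q∣ ⁅ x ⁆ (⁅ y ⁆ ∪ ⁅ z ⁆) ⟩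
  ∣ ⁅ x ⁆ ∣ + ∣ ⁅ y ⁆ ∪ ⁅ z ⁆ ∣       ≤⟨ +-monoʳ-≤ ∣ ⁅ x ⁆ ∣ (∣p∪q∣≤∣p∣+∣q∣ ⁅ y ⁆ ⁅ z ⁆) ⟩
  ∣ ⁅ x ⁆ ∣ + (∣ ⁅ y ⁆ ∣ + ∣ ⁅ z ⁆ ∣) ≡⟨ cong₂ _+_ (∣⁅x⁆∣≡1 x) (cong₂ _+_ (∣⁅x⁆∣≡1 y) (∣⁅x⁆∣≡1 z)) ⟩
  3                                   ∎
  where open ≤-Reasoning

∉⁅x⁆∪⁅y⁆∪⁅z⁆ : ∀ {n} {w x y z : Fin n} → w ≢ x → w ≢ y → w ≢ z → w ∉ ⁅ x ⁆ ∪ ⁅ y ⁆ ∪ ⁅ z ⁆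
∉⁅x⁆∪⁅y⁆∪⁅z⁆ {x = x} {y} {z} w≢x w≢y w≢z w∈ =
  [ w≢x ∘ x∈⁅y⁆⇒x≡y x
  , [ w≢y ∘ x∈⁅y⁆⇒x≡y y , w≢z ∘ x∈⁅y⁆⇒x≡y z ]′ ∘ x∈p∪q⁻ ⁅ y ⁆ ⁅ z ⁆
  ]′ (x∈p∪q⁻ ⁅ x ⁆ _ w∈)

module _ {n : ℕ} (σ : Permutation′ n) where

  Invariant : Subset n → Set
  Invariant v = ∀ x → lookup v (σ ⟨$⟩ʳ x) ≡ lookup v x

  image≡⇒invariant : ∀ {v} → image σ v ≡ v → Invariant v
  image≡⇒invariant {v} σv≡v x = begin
    lookup v (σ ⟨$⟩ʳ x)           ≡⟨ cong (λ w → lookup w (σ ⟨$⟩ʳ x)) σv≡v ⟨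
    lookup (image σ v) (σ ⟨$⟩ʳ x) ≡⟨ lookup∘tabulate _ (σ ⟨$⟩ʳ x) ⟩
    lookup v (σ ⟨$⟩ˡ (σ ⟨$⟩ʳ x))  ≡⟨ cong (lookup v) (inverseˡ σ) ⟩
    lookup v x                    ∎
    where open ≡-Reasoning

  invariant⇒image≡ : ∀ {v} → Invariant v → image σ v ≡ v
  invariant⇒image≡ {v} inv =
    trans (tabulate-cong (λ j → trans (sym (inv (σ ⟨$⟩ˡ j))) (cong (lookup v) (inverseʳ σ))))
          (tabulate∘lookup v)

  -- numF k σ is, by definition, count n (sized? k (fixed? σ)).
  fixed? : Decidable (λ v → image σ v ≡ v)
  fixed? v = ≡-dec _≟ᵇ_ (image σ v) v

module _ {n : ℕ} (i j : Fin n) where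

  transpose-matchˡ : transpose i j ⟨$⟩ʳ i ≡ j
  transpose-matchˡ with i ≟ᶠ i
  ... | yes _   = refl
  ... | no i≢i = ⊥-elim (i≢i refl)

  agree⇒transpose-invariant : ∀ {v} → lookup v i ≡ lookup v j → Invariant (transpose i j) v
  agree⇒transpose-invariant vi≡vj x with x ≟ᶠ i
  ... | yes refl = sym vi≡vj
  ... | no _ with x ≟ᶠ j
  ...   | yes refl = vi≡vj
  ...   | no _     = refl

≈transpose : ∀ {n} (σ : Permutation′ n) a b → σ ⟨$⟩ʳ a ≡ b → σ ⟨$⟩ʳ b ≡ a →
             (∀ x → x ≢ a → x ≢ b → σ ⟨$⟩ʳ x ≡ x) → ∀ x → σ ⟨$⟩ʳ x ≡ transpose a b ⟨$⟩ʳ x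
≈transpose σ a b σa≡b σb≡a σx≡x x with x ≟ᶠ a
... | yes refl = σa≡b
... | no x≢a with x ≟ᶠ b
...   | yes refl = σb≡a
...   | no x≢b   = σx≡x x x≢a x≢b

module _ {n k : ℕ} (σ : Permutation′ n) {a : Fin n} (σa≢a : σ ⟨$⟩ʳ a ≢ a)
         (1≤k : 1 ≤ k) (k+3≤n : k + 3 ≤ n)
         (agree⇒invariant : ∀ v → ∣ v ∣ ≡ k → lookup v a ≡ lookup v (σ ⟨$⟩ʳ a) → Invariant σ v)
         where

  private
    b = σ ⟨$⟩ʳ a

    invariant-separating-set : ∀ z e → z ≢ a → z ≢ b → z ≢ e →
                               ∃[ v ] Invariant σ v × lookup v z ≢ lookup v e
    invariant-separating-set z e z≢a z≢b z≢e
      with ∃-sized-∋-avoiding k z (⁅ a ⁆ ∪ ⁅ b ⁆ ∪ ⁅ e ⁆) (∉⁅x⁆∪⁅y⁆∪⁅z⁆ z≢a z≢b z≢e) 1≤k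
             (≤-trans (+-monoʳ-≤ k (∣⁅x⁆∪⁅y⁆∪⁅z⁆∣≤3 a b e)) k+3≤n)
    ... | v , ∣v∣≡k , vz , avoid =
      v , agree⇒invariant v ∣v∣≡k (trans va (sym vb)) ,
      λ vz≡ve → contradiction (trans (sym vz) (trans vz≡ve ve)) λ ()
      where
      va = avoid (x∈p∪q⁺ (inj₁ (x∈⁅x⁆ a)))
      vb = avoid (x∈p∪q⁺ (inj₂ (x∈p∪q⁺ (inj₁ (x∈⁅x⁆ b)))))
      ve = avoid (x∈p∪q⁺ (inj₂ (x∈p∪q⁺ (inj₂ (x∈⁅x⁆ e)))))

    σb≢b : σ ⟨$⟩ʳ b ≢ b
    σb≢b = σa≢a ∘ Injection.injective (↔⇒↣ σ)

    σb≡a : σ ⟨$⟩ʳ b ≡ a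
    σb≡a = decidable-stable (σ ⟨$⟩ʳ b ≟ᶠ a) λ σb≢a →
      let v , inv , separates = invariant-separating-set (σ ⟨$⟩ʳ b) b σb≢a σb≢b σb≢b
      in separates (inv b)

    σx≡x : ∀ x → x ≢ a → x ≢ b → σ ⟨$⟩ʳ x ≡ x
    σx≡x x x≢a x≢b = decidable-stable (σ ⟨$⟩ʳ x ≟ᶠ x) λ σx≢x →
      let v , inv , separates = invariant-separating-set x (σ ⟨$⟩ʳ x) x≢a x≢b (σx≢x ∘ sym)
      in separates (sym (inv x))

  agreeing-invariant⇒≈transpose : ∀ x → σ ⟨$⟩ʳ x ≡ transpose a b ⟨$⟩ʳ x
  agreeing-invariant⇒≈transpose = ≈transpose σ a b refl σb≡a σx≡x

module _ {m : ℕ} (k : ℕ) (σ : Permutation′ (suc (suc m))) where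

  private
    fixed⊆agree : ∀ a {v} → ∣ v ∣ ≡ k × image σ v ≡ v → ∣ v ∣ ≡ k × lookup v a ≡ lookup v (σ ⟨$⟩ʳ a)
    fixed⊆agree a = map₂ (λ fixed → sym (image≡⇒invariant σ fixed a))

    count-agree : ∀ a → σ ⟨$⟩ʳ a ≢ a → count _ (sized? k (agree? a (σ ⟨$⟩ʳ a))) ≡ pairCount m k
    count-agree a σa≢a = count-sized-agree m k a (σ ⟨$⟩ʳ a) (σa≢a ∘ sym)

  numF≤pairCount : ∀ a → σ ⟨$⟩ʳ a ≢ a → numF k σ ≤ pairCount m k
  numF≤pairCount a σa≢a = ≤-trans
    (count-mono (sized? k (fixed? σ)) (sized? k (agree? a (σ ⟨$⟩ʳ a))) (fixed⊆agree a))
    (≤-reflexive (count-agree a σa≢a))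

  numF≡pairCount⇒transposition : ∀ a → σ ⟨$⟩ʳ a ≢ a → 1 ≤ k → k + 3 ≤ suc (suc m) →
                                 numF k σ ≡ pairCount m k → IsTransposition σ
  numF≡pairCount⇒transposition a σa≢a 1≤k k+3≤n numF≡pairCount =
    a , σ ⟨$⟩ʳ a , σa≢a ∘ sym , agreeing-invariant⇒≈transpose σ σa≢a 1≤k k+3≤n agree⇒invariant
    where
    agree⇒invariant : ∀ v → ∣ v ∣ ≡ k → lookup v a ≡ lookup v (σ ⟨$⟩ʳ a) → Invariant σ v
    agree⇒invariant v ∣v∣≡k agree = image≡⇒invariant σ (proj₂ (count-mono-≡⇒⊇
      (sized? k (fixed? σ)) (sized? k (agree? a (σ ⟨$⟩ʳ a))) (fixed⊆agree a)
      (trans numF≡pairCount (sym (count-agree a σa≢a))) {v} (∣v∣≡k , agree)))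

  transposition⇒numF≡pairCount : IsTransposition σ → numF k σ ≡ pairCount m k
  transposition⇒numF≡pairCount (i , j , i≢j , σ≈τ) = trans
    (count-sized-cong _ k (fixed? σ) (agree? i j) (fixed⇒agree , agree⇒fixed))
    (count-sized-agree m k i j i≢j)
    where
    fixed⇒agree : ∀ {v} → image σ v ≡ v → lookup v i ≡ lookup v j
    fixed⇒agree {v} fixed =
      trans (sym (image≡⇒invariant σ fixed i))
            (cong (lookup v) (trans (σ≈τ i) (transpose-matchˡ i j)))
    agree⇒fixed : ∀ {v} → lookup v i ≡ lookup v j → image σ v ≡ v
    agree⇒fixed {v} vi≡vj = invariant⇒image≡ σ
      (λ x → trans (cong (lookup v) (σ≈τ x)) (agree⇒transpose-invariant i j {v} vi≡vj x))

k+3≤n : ∀ k {n} → 2 * k < n → 4 < n → k + 3 ≤ n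
k+3≤n k {n} 2k<n 4<n with k ≤? 2
... | yes k≤2 = ≤-trans (+-monoˡ-≤ 3 k≤2) 4<n
... | no  k≰2 = begin
  k + 3       ≤⟨ +-monoʳ-≤ k (≰⇒> k≰2) ⟩
  k + k       ≡⟨ cong (k +_) (+-identityʳ k) ⟨
  2 * k       <⟨ 2k<n ⟩
  n           ∎
  where open ≤-Reasoning

mainTheorem3 : (k n : ℕ) → 1 ≤ k → 2 * k < n → 4 < n →
    (σ : Permutation′ n) → ¬ IsIdentity σ →
    (numF k σ ≤ binomKm2 (n ∸ 2) k + ((n ∸ 2) C k))
    × ((numF k σ ≡ binomKm2 (n ∸ 2) k + ((n ∸ 2) C k)) ⇔ IsTransposition σ)
mainTheorem3 k zero          _   _    ()       _ _
mainTheorem3 k (suc zero)    _   _    (s≤s ()) _ _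
mainTheorem3 k (suc (suc m)) 1≤k 2k<n 4<n σ σ≢id =
  numF≤pairCount k σ a σa≢a ,
  mk⇔ (numF≡pairCount⇒transposition k σ a σa≢a 1≤k (k+3≤n k 2k<n 4<n))
      (transposition⇒numF≡pairCount k σ)
  where
  moved = ¬∀⟶∃¬ _ _ (λ x → σ ⟨$⟩ʳ x ≟ᶠ x) σ≢id
  a = proj₁ moved
  σa≢a = proj₂ moved
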